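{- Let $A(x) = \sum_{i=0}^d a_i x^i \in \mathbb{Z}[x]$ be a primitive polynomial of degree $d$ with $a_0\neq 0$, and let $m>d$. Let $\Lambda_m \subseteq \mathbb{Z}^m$ be the $\mathbb{Z}$-module of integral vectors $(x_1,\dots,x_m)$ satisfying $\sum_{i=0}^d a_i x_{j+i}=0$ for $1\le j\le m-d$, and let $\Theta_m \subseteq \mathbb{Z}^d\times\mathbb{Q}^{m-d}$ be the $\mathbb{Z}$-module of vectors $(x_1,\dots,x_m)\in\mathbb{Q}^m$ satisfying the same recurrence and with $x_1,\dots,x_d\in\mathbb{Z}$. Then $\Lambda_m\subseteq\Theta_m$ has index $|a_d|^{m-d}$. -}

module Defs where

open import Data.Nat as ℕ using (ℕ; zero; suc; _<_; _<?_; _∸_; _^_)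
open import Data.Integer as ℤ using (ℤ)
open import Data.Integer.Divisibility using () renaming (_∣_ to _∣ℤ_)
open import Data.Rational as ℚ using (ℚ; _/_; 0ℚ)
open import Data.Fin using (Fin; fromℕ<; fromℕ; toℕ)
import Data.Fin as Fin
open import Data.Product using (Σ; ∃; _×_)
open import Relation.Nullary using (¬_; yes; no)
open import Relation.Binary.PropositionalEquality using (_≡_)

ι : ℤ → ℚ
ι z = z / 1

IsInt : ℚ → Set
IsInt q = ∃ λ (z : ℤ) → q ≡ ι z

sumℚ : (n : ℕ) → (Fin n → ℚ) → ℚ
sumℚ zero    f = 0ℚ
sumℚ (suc n) f = f Fin.zero ℚ.+ sumℚ n (λ i → f (Fin.suc i))

-- a polynomial A(x) = Σ_{i=0}^d a_i x^i ∈ ℤ[x] given by coefficients a : Fin (suc d) → ℤ,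
-- a i = a_i.

Primitive : (d : ℕ) → (Fin (suc d) → ℤ) → Set
Primitive d a = ∀ (k : ℤ) → (∀ i → k ∣ℤ a i) → k ∣ℤ ℤ.1ℤ

lead : (d : ℕ) → (Fin (suc d) → ℤ) → ℤ
lead d a = a (fromℕ d)

-- total access to a vector x = (x_0,...,x_{m-1}) (0-indexed; out of range gives 0)
at : {m : ℕ} → (Fin m → ℚ) → ℕ → ℚ
at {m} x k with k <? m
... | yes k<m = x (fromℕ< k<m)
... | no  _   = 0ℚ

-- the recurrence Σ_{i=0}^d a_i x_{j+i} = 0 for every admissible window
-- (0-indexed: 0 ≤ j and j + d < m, i.e. the paper's 1 ≤ j ≤ m - d)
Rec : (d : ℕ) → (Fin (suc d) → ℤ) → (m : ℕ) → (Fin m → ℚ) → Set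
Rec d a m x = ∀ (j : ℕ) → ℕ._+_ j d < m →
  sumℚ (suc d) (λ i → ι (a i) ℚ.* at x (ℕ._+_ j (toℕ i))) ≡ 0ℚ

InΛ : (d : ℕ) → (Fin (suc d) → ℤ) → (m : ℕ) → (Fin m → ℚ) → Set
InΛ d a m x = Rec d a m x × (∀ (i : Fin m) → IsInt (x i))

InΘ : (d : ℕ) → (Fin (suc d) → ℤ) → (m : ℕ) → (Fin m → ℚ) → Set
InΘ d a m x = Rec d a m x × (∀ (i : Fin m) → toℕ i < d → IsInt (x i))

_⊖_ : {m : ℕ} → (Fin m → ℚ) → (Fin m → ℚ) → (Fin m → ℚ)
(x ⊖ y) i = x i ℚ.- y i

-- Λ ⊆ Θ has (finite) index N: there is a complete, irredundant system of
-- N representatives in Θ for the cosets of Λ, i.e. Θ/Λ has exactly N elements.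
HasIndex : (d : ℕ) → (Fin (suc d) → ℤ) → (m : ℕ) → ℕ → Set
HasIndex d a m N =
  Σ (Fin N → (Fin m → ℚ)) λ r →
      (∀ k → InΘ d a m (r k))
    × (∀ x → InΘ d a m x → ∃ λ k → InΛ d a m (x ⊖ r k))
    × (∀ k l → InΛ d a m (r k ⊖ r l) → k ≡ l)

module Submission where

-- Notation: c = a_d is the leading coefficient, n = m - d the number of windows
-- (the recurrence Σ_i a_i x_{j+i} = 0 is imposed for j < n) and C = c^n.
--
-- 1. Clearing denominators: for x ∈ Θ_m the vector C·x is integral (induction
--    along the recurrence, which expresses c·x_p through earlier entries).  So x ↦ C·x
--    identifies Θ_m with the integer kernel sequences X that are ≡ 0 mod C on
--    [0, d), and Λ_m with those that are ≡ 0 mod C everywhere.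
-- 2. The window map ℤ^m → ℤ^n is surjective: modulo a prime p the first
--    coefficient not divisible by p is a pivot (this is where primitivity is
--    used), hence modulo every nonzero integer, and exactly after absorbing the
--    error by triangular solving with the leading coefficient c.
-- 3. Surjectivity yields kernel elements w_0, …, w_{n-1}: w_t ≡ 0 mod C below
--    position t + d and w_t ≡ -c^(n-1) mod C at position t + d.
-- 4. The combinations Σ_t l_t·w_t with digits 0 ≤ l_t < |c| represent every
--    kernel class modulo C exactly once: position t + d is reduced with w_t, and
--    modulo C it determines the digit l_t modulo c.
-- Hence Θ_m / Λ_m has |c|^n elements.

open import Defs
open import Level using (_⊔_)
open import Function using (_∘_)
open import Algebra.Bundles using (AbelianGroup)
open import Data.Nat as ℕ using (ℕ; zero; suc; _<_; _≤_; _∸_; _^_; _<?_; z≤n; s≤s)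
import Data.Nat.Properties as ℕP
open import Data.Nat.Induction using (<-rec)
import Data.Nat.Divisibility as ℕ∣
open import Data.Nat.Primality using (Prime; prime⇒irreducible; prime⇒nonTrivial)
open import Data.Nat.Primality.Factorisation using (factorise; PrimeFactorisation)
open import Data.Nat.Coprimality using (Coprime; coprime-Bézout)
open import Data.Nat.GCD using (module Bézout)
open import Data.Nat.ListAction using (product)
open import Data.List using ([]; _∷_)
open import Data.List.Relation.Unary.All using (All; []; _∷_)
open import Data.Integer as ℤ using (ℤ; ∣_∣; 0ℤ; 1ℤ; -1ℤ; +_; -[1+_])
import Data.Integer.Properties as ℤP
import Data.Integer.DivMod as ℤD
open import Data.Integer.Divisibility.Signed as ℤ∣ using (divides)
open import Data.Integer.Tactic.RingSolver using (solve-∀)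
open import Data.Rational as ℚ using (ℚ)
import Data.Rational.Properties as ℚP
import Data.Rational.Unnormalised as ℚᵘ
import Data.Rational.Unnormalised.Properties as ℚᵘP
open import Data.Rational.Solver using (module +-*-Solver)
open import Data.Fin as Fin using (Fin; toℕ; fromℕ; fromℕ<; punchIn; funToFin; finToFun)
import Data.Fin.Properties as FinP
open import Data.Product using (Σ; ∃; _×_; _,_; proj₁; proj₂)
open import Data.Sum using (_⊎_; inj₁; inj₂)
open import Data.Empty using (⊥-elim)
open import Relation.Nullary using (¬_; yes; no)
open import Relation.Unary using (Decidable)
open import Relation.Binary.PropositionalEquality
open import Algebra.Properties.Semiring.Sum ℤP.+-*-semiring
  using (sum; sum-cong-≗; sum-replicate-zero; sum-remove; ∑-distrib-+; *-distribˡ-sum)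
open +-*-Solver using (solve; _:=_; _:*_; _:-_)

module SubgroupSums {c ℓ} (G : AbelianGroup c ℓ) where
  open AbelianGroup G
    using (Carrier; _≈_; _∙_; ε; _⁻¹; ∙-congʳ; commutativeMonoid; group)
    renaming (trans to ≈-trans)
  open import Algebra.Properties.CommutativeMonoid.Sum commutativeMonoid
    public using () renaming (sum to ∑; sum-remove to ∑-remove)
  open import Algebra.Properties.Group group using (//-rightDividesʳ)

  record IsSubgroup (P : Carrier → Set) : Set (c ⊔ ℓ) where
    field
      respects  : ∀ {x y} → x ≈ y → P x → P y
      ε-closed  : P ε
      ∙-closed  : ∀ {x y} → P x → P y → P (x ∙ y)
      ⁻¹-closed : ∀ {x} → P x → P (x ⁻¹)

  module _ {P : Carrier → Set} (sub : IsSubgroup P) where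
    open IsSubgroup sub

    sum-closed : ∀ n (f : Fin n → Carrier) → (∀ i → P (f i)) → P (∑ f)
    sum-closed zero    f h = ε-closed
    sum-closed (suc n) f h = ∙-closed (h Fin.zero) (sum-closed n (λ i → f (Fin.suc i)) (λ i → h (Fin.suc i)))

    -- ∑ f = f k ∙ (sum of the other terms), so f k = ∑ f ∙ (other terms)⁻¹.
    sum-except : ∀ n (f : Fin (suc n) → Carrier) (k : Fin (suc n)) →
                 (∀ i → i ≢ k → P (f i)) → P (∑ f) → P (f k)
    sum-except n f k others total =
      respects (≈-trans (∙-congʳ (∑-remove {i = k} f)) (//-rightDividesʳ rest (f k)))
        (∙-closed total (⁻¹-closed (sum-closed n (λ i → f (punchIn k i)) punched)))
      where
      rest : Carrier
      rest = ∑ (λ i → f (punchIn k i))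
      punched : ∀ i → P (f (punchIn k i))
      punched i = others (punchIn k i) (FinP.punchInᵢ≢i k i)

open SubgroupSums ℤP.+-0-abelianGroup

multiples : (q : ℤ) → IsSubgroup (q ℤ∣.∣_)
multiples q = record
  { respects  = λ eq → subst (q ℤ∣.∣_) eq
  ; ε-closed  = divides 0ℤ refl
  ; ∙-closed  = ℤ∣.∣m∣n⇒∣m+n
  ; ⁻¹-closed = ℤ∣.∣m⇒∣-m
  }

sum-single : ∀ n (f : Fin (suc n) → ℤ) (k : Fin (suc n)) → (∀ i → i ≢ k → f i ≡ 0ℤ) → sum f ≡ f k
sum-single n f k others = begin
  sum f                                 ≡⟨ sum-remove {i = k} f ⟩
  f k ℤ.+ sum (λ i → f (punchIn k i))   ≡⟨ cong (ℤ._+_ (f k)) rest≡0 ⟩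
  f k ℤ.+ 0ℤ                            ≡⟨ ℤP.+-identityʳ (f k) ⟩
  f k                                   ∎
  where
  open ≡-Reasoning
  rest≡0 : sum (λ i → f (punchIn k i)) ≡ 0ℤ
  rest≡0 = trans (sum-cong-≗ (λ i → others (punchIn k i) (FinP.punchInᵢ≢i k i))) (sum-replicate-zero n)

-- Integer sequences; a vector of ℤ^m is the restriction of a sequence to [0, m).
Seq : Set
Seq = ℕ → ℤ

infixl 6 _⊕_
infixl 7 _⊛_

_⊕_ : Seq → Seq → Seq
(v ⊕ w) i = v i ℤ.+ w i

_⊛_ : ℤ → Seq → Seq
(k ⊛ v) i = k ℤ.* v i

𝟎 : Seq
𝟎 _ = 0ℤ

e : ℕ → Seq
e P x with x ℕ.≟ P
... | yes _ = 1ℤ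
... | no  _ = 0ℤ

e-at : ∀ P → e P P ≡ 1ℤ
e-at P with P ℕ.≟ P
... | yes _ = refl
... | no P≢P = ⊥-elim (P≢P refl)

e-off : ∀ P x → x ≢ P → e P x ≡ 0ℤ
e-off P x x≢P with x ℕ.≟ P
... | yes x≡P = ⊥-elim (x≢P x≡P)
... | no  _   = refl

e-support : ∀ P x → x ≡ P ⊎ e P x ≡ 0ℤ
e-support P x with x ℕ.≟ P
... | yes x≡P = inj₁ x≡P
... | no  _   = inj₂ refl

module Windows (d : ℕ) (a : Fin (suc d) → ℤ) where

  c : ℤ
  c = lead d a

  S : Seq → ℕ → ℤ
  S v j = sum (λ i → a i ℤ.* v (j ℕ.+ toℕ i))

  S-⊕ : ∀ v w j → S (v ⊕ w) j ≡ S v j ℤ.+ S w j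
  S-⊕ v w j = trans (sum-cong-≗ (λ i → ℤP.*-distribˡ-+ (a i) (v (j ℕ.+ toℕ i)) (w (j ℕ.+ toℕ i))))
                    (∑-distrib-+ (λ i → a i ℤ.* v (j ℕ.+ toℕ i)) (λ i → a i ℤ.* w (j ℕ.+ toℕ i)))

  S-⊛ : ∀ k v j → S (k ⊛ v) j ≡ k ℤ.* S v j
  S-⊛ k v j = trans (sum-cong-≗ (λ i → swap (a i) k (v (j ℕ.+ toℕ i))))
                    (sym (*-distribˡ-sum k (λ i → a i ℤ.* v (j ℕ.+ toℕ i))))
    where swap : ∀ x y z → x ℤ.* (y ℤ.* z) ≡ y ℤ.* (x ℤ.* z)
          swap = solve-∀

  S-⊛⊕ : ∀ k v w j → S (k ⊛ v ⊕ w) j ≡ k ℤ.* S v j ℤ.+ S w j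
  S-⊛⊕ k v w j = trans (S-⊕ (k ⊛ v) w j) (cong (ℤ._+ S w j) (S-⊛ k v j))

  S-local : ∀ v w j → (∀ i → i ≤ d → v (j ℕ.+ i) ≡ w (j ℕ.+ i)) → S v j ≡ S w j
  S-local v w j h = sum-cong-≗ (λ i → cong (a i ℤ.*_) (h (toℕ i) (ℕP.≤-pred (FinP.toℕ<n i))))

  S-vanish : ∀ v j → (∀ i → i ≤ d → v (j ℕ.+ i) ≡ 0ℤ) → S v j ≡ 0ℤ
  S-vanish v j h = trans (S-local v 𝟎 j h)
    (trans (sum-cong-≗ (λ i → ℤP.*-zeroʳ (a i))) (sum-replicate-zero (suc d)))

  S-e-before : ∀ P j → j ℕ.+ d < P → S (e P) j ≡ 0ℤ
  S-e-before P j j+d<P = S-vanish (e P) j λ i i≤d →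
    e-off P (j ℕ.+ i) λ eq → ℕP.<-irrefl eq (ℕP.≤-<-trans (ℕP.+-monoʳ-≤ j i≤d) j+d<P)

  S-e-hit : ∀ j (r : Fin (suc d)) → S (e (j ℕ.+ toℕ r)) j ≡ a r
  S-e-hit j r = trans (sum-single d _ r off) (trans (cong (a r ℤ.*_) (e-at _)) (ℤP.*-identityʳ (a r)))
    where
    off : ∀ i → i ≢ r → a i ℤ.* e (j ℕ.+ toℕ r) (j ℕ.+ toℕ i) ≡ 0ℤ
    off i i≢r = trans (cong (a i ℤ.*_) (e-off _ _ λ eq → i≢r (FinP.toℕ-injective (ℕP.+-cancelˡ-≡ j _ _ eq))))
                      (ℤP.*-zeroʳ (a i))

  S-e-last : ∀ j → S (e (j ℕ.+ d)) j ≡ c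
  S-e-last j = subst (λ t → S (e (j ℕ.+ t)) j ≡ c) (FinP.toℕ-fromℕ d) (S-e-hit j (fromℕ d))

  S-e-early : ∀ t j → j ≤ t → S (e (t ℕ.+ d)) j ≡ c ℤ.* e t j
  S-e-early t j j≤t with ℕP.m≤n⇒m<n∨m≡n j≤t
  ... | inj₁ j<t  = trans (S-e-before (t ℕ.+ d) j (ℕP.+-monoˡ-< d j<t))
                          (sym (trans (cong (c ℤ.*_) (e-off t j (λ eq → ℕP.<-irrefl eq j<t))) (ℤP.*-zeroʳ c)))
  ... | inj₂ refl = trans (S-e-last j) (sym (trans (cong (c ℤ.*_) (e-at j)) (ℤP.*-identityʳ c)))

  S-e-later : ∀ (q : ℤ) (r : Fin (suc d)) → (∀ i → toℕ i < toℕ r → q ℤ∣.∣ a i) →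
              ∀ j → q ℤ∣.∣ S (e (toℕ r)) (suc j)
  S-e-later q r q∣low j = sum-closed (multiples q) (suc d) _ term
    where
    term : ∀ i → q ℤ∣.∣ (a i ℤ.* e (toℕ r) (suc (j ℕ.+ toℕ i)))
    term i with e-support (toℕ r) (suc (j ℕ.+ toℕ i))
    ... | inj₂ off = subst (q ℤ∣.∣_) (sym (trans (cong (a i ℤ.*_) off) (ℤP.*-zeroʳ (a i)))) (divides 0ℤ refl)
    ... | inj₁ hit = ℤ∣.∣m⇒∣m*n _ (q∣low i (subst (toℕ i <_) hit (s≤s (ℕP.m≤n+m (toℕ i) j))))

InvertibleMod : ℤ → ℤ → Set
InvertibleMod q z = Σ ℤ λ α → Σ ℤ λ β → α ℤ.* z ≡ 1ℤ ℤ.+ β ℤ.* q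

invertible-abs : ∀ q z → InvertibleMod q (+ ∣ z ∣) → InvertibleMod q z
invertible-abs q (+ n)      inv           = inv
invertible-abs q -[1+ n ] (α , β , eq) = ℤ.- α , β , trans (flip α -[1+ n ]) eq
  where flip : ∀ x y → ℤ.- x ℤ.* y ≡ x ℤ.* ℤ.- y
        flip = solve-∀

coprime-invertible : ∀ {p n} → Coprime p n → InvertibleMod (+ p) (+ n)
coprime-invertible {p} {n} cop with coprime-Bézout cop
... | Bézout.+- x y eq = ℤ.- (+ y) , ℤ.- (+ x) , (begin
  ℤ.- (+ y) ℤ.* (+ n)                  ≡⟨ rearrange (+ y) (+ n) ⟩
  1ℤ ℤ.+ ℤ.- (1ℤ ℤ.+ (+ y) ℤ.* (+ n))  ≡⟨ cong (λ t → 1ℤ ℤ.+ ℤ.- t) lifted ⟩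
  1ℤ ℤ.+ ℤ.- ((+ x) ℤ.* (+ p))         ≡⟨ cong (ℤ._+_ 1ℤ) (ℤP.neg-distribˡ-* (+ x) (+ p)) ⟩
  1ℤ ℤ.+ ℤ.- (+ x) ℤ.* (+ p)           ∎)
  where
  open ≡-Reasoning
  lifted : 1ℤ ℤ.+ (+ y) ℤ.* (+ n) ≡ (+ x) ℤ.* (+ p)
  lifted = trans (cong (ℤ._+_ 1ℤ) (sym (ℤP.pos-* y n))) (trans (cong +_ eq) (ℤP.pos-* x p))
  rearrange : ∀ y n → ℤ.- y ℤ.* n ≡ 1ℤ ℤ.+ ℤ.- (1ℤ ℤ.+ y ℤ.* n)
  rearrange = solve-∀
... | Bézout.-+ x y eq = (+ y) , (+ x) ,
  sym (trans (cong (ℤ._+_ 1ℤ) (sym (ℤP.pos-* x p))) (trans (cong +_ eq) (ℤP.pos-* y n)))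

prime-invertible : ∀ {p} z → Prime p → ¬ (+ p ℤ∣.∣ z) → InvertibleMod (+ p) z
prime-invertible {p} z pr p∤z = invertible-abs (+ p) z (coprime-invertible coprime)
  where
  coprime : Coprime p ∣ z ∣
  coprime {k} (k∣p , k∣z) with prime⇒irreducible pr k∣p
  ... | inj₁ k≡1    = k≡1
  ... | inj₂ refl   = ⊥-elim (p∤z (ℤ∣.∣ᵤ⇒∣ k∣z))

least-failure : ∀ n (P : Fin n → Set) → Decidable P → ¬ (∀ i → P i) →
                ∃ λ r → ¬ P r × (∀ i → toℕ i < toℕ r → P i)
least-failure n P P? ¬all with FinP.¬∀⟶∃¬-smallest n P P? ¬all
... | r , ¬Pr , below = r , ¬Pr , λ i i<r →
  subst P (FinP.toℕ-injective (trans (FinP.toℕ-inject (fromℕ< i<r)) (FinP.toℕ-fromℕ< i<r))) (below (fromℕ< i<r))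

-- Window sums are surjective modulo every nonzero integer, provided the
-- coefficients are coprime.  The proof goes prime by prime: modulo p the
-- first coefficient a_r not divisible by p is a unit, and serves as a pivot.
module Solvability (d : ℕ) (a : Fin (suc d) → ℤ) where
  open Windows d a

  SolvableMod : ℕ → ℤ → Set
  SolvableMod N q = ∀ (F : Seq) → Σ Seq λ v → Σ Seq λ Z → ∀ j → j < N → F j ≡ S v j ℤ.+ q ℤ.* Z j

  solvable-1 : ∀ N → SolvableMod N 1ℤ
  solvable-1 N F = 𝟎 , F , λ j _ → sym (begin
    S 𝟎 j ℤ.+ 1ℤ ℤ.* F j ≡⟨ cong (ℤ._+ 1ℤ ℤ.* F j) (S-vanish 𝟎 j (λ _ _ → refl)) ⟩
    0ℤ ℤ.+ 1ℤ ℤ.* F j    ≡⟨ ℤP.+-identityˡ _ ⟩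
    1ℤ ℤ.* F j           ≡⟨ ℤP.*-identityˡ _ ⟩
    F j                  ∎)
    where open ≡-Reasoning

  -- solve modulo q₁, then solve for the error term modulo q₂
  solvable-* : ∀ N q₁ q₂ → SolvableMod N q₁ → SolvableMod N q₂ → SolvableMod N (q₁ ℤ.* q₂)
  solvable-* N q₁ q₂ sol₁ sol₂ F with sol₁ F
  ... | v₁ , Z₁ , h₁ with sol₂ Z₁
  ... | v₂ , Z₂ , h₂ = v₁ ⊕ q₁ ⊛ v₂ , Z₂ , λ j j<N → begin
    F j                                              ≡⟨ h₁ j j<N ⟩
    S v₁ j ℤ.+ q₁ ℤ.* Z₁ j                           ≡⟨ cong (λ t → S v₁ j ℤ.+ q₁ ℤ.* t) (h₂ j j<N) ⟩
    S v₁ j ℤ.+ q₁ ℤ.* (S v₂ j ℤ.+ q₂ ℤ.* Z₂ j)       ≡⟨ expand (S v₁ j) q₁ q₂ (S v₂ j) (Z₂ j) ⟩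
    S v₁ j ℤ.+ q₁ ℤ.* S v₂ j ℤ.+ q₁ ℤ.* q₂ ℤ.* Z₂ j  ≡⟨ cong (λ t → S v₁ j ℤ.+ t ℤ.+ q₁ ℤ.* q₂ ℤ.* Z₂ j) (sym (S-⊛ q₁ v₂ j)) ⟩
    S v₁ j ℤ.+ S (q₁ ⊛ v₂) j ℤ.+ q₁ ℤ.* q₂ ℤ.* Z₂ j  ≡⟨ cong (ℤ._+ q₁ ℤ.* q₂ ℤ.* Z₂ j) (sym (S-⊕ v₁ (q₁ ⊛ v₂) j)) ⟩
    S (v₁ ⊕ q₁ ⊛ v₂) j ℤ.+ q₁ ℤ.* q₂ ℤ.* Z₂ j        ∎
    where
    open ≡-Reasoning
    expand : ∀ s x y t z → s ℤ.+ x ℤ.* (t ℤ.+ y ℤ.* z) ≡ s ℤ.+ x ℤ.* t ℤ.+ x ℤ.* y ℤ.* z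
    expand = solve-∀

  solvable-divisor : ∀ N q q' → q ℤ∣.∣ q' → SolvableMod N q' → SolvableMod N q
  solvable-divisor N q q' (divides k q'≡kq) sol F with sol F
  ... | v , Z , h = v , k ⊛ Z , λ j j<N →
    trans (h j j<N) (cong (ℤ._+_ (S v j)) (trans (cong (ℤ._* Z j) q'≡kq) (regroup k q (Z j))))
    where regroup : ∀ x y z → x ℤ.* y ℤ.* z ≡ y ℤ.* (x ℤ.* z)
          regroup = solve-∀

  -- the integer identity behind the pivot step: if α·a ≡ 1 + β·q, then adding
  -- α·(f - s) copies of a to s hits f up to the multiple -(f - s)·β of q
  pivot-repair : ∀ (s f α β a q : ℤ) → α ℤ.* a ≡ 1ℤ ℤ.+ β ℤ.* q →
                 s ℤ.+ α ℤ.* (f ℤ.- s) ℤ.* a ℤ.+ q ℤ.* ℤ.- ((f ℤ.- s) ℤ.* β) ≡ f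
  pivot-repair s f α β a q unit = begin
    s ℤ.+ α ℤ.* (f ℤ.- s) ℤ.* a ℤ.+ q ℤ.* ℤ.- ((f ℤ.- s) ℤ.* β)   ≡⟨ collect s α f a q β ⟩
    s ℤ.+ (f ℤ.- s) ℤ.* (α ℤ.* a) ℤ.- q ℤ.* (f ℤ.- s) ℤ.* β       ≡⟨ cong (λ u → s ℤ.+ (f ℤ.- s) ℤ.* u ℤ.- q ℤ.* (f ℤ.- s) ℤ.* β) unit ⟩
    s ℤ.+ (f ℤ.- s) ℤ.* (1ℤ ℤ.+ β ℤ.* q) ℤ.- q ℤ.* (f ℤ.- s) ℤ.* β ≡⟨ cancel s f β q ⟩
    f                                                            ∎
    where
    open ≡-Reasoning
    collect : ∀ s x f y q b → s ℤ.+ x ℤ.* (f ℤ.- s) ℤ.* y ℤ.+ q ℤ.* ℤ.- ((f ℤ.- s) ℤ.* b)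
                            ≡ s ℤ.+ (f ℤ.- s) ℤ.* (x ℤ.* y) ℤ.- q ℤ.* (f ℤ.- s) ℤ.* b
    collect = solve-∀
    cancel : ∀ s f b q → s ℤ.+ (f ℤ.- s) ℤ.* (1ℤ ℤ.+ b ℤ.* q) ℤ.- q ℤ.* (f ℤ.- s) ℤ.* b ≡ f
    cancel = solve-∀

  shift : Seq → Seq
  shift v zero    = 0ℤ
  shift v (suc i) = v i

  -- Pivot step: if a_r is a unit modulo q and q divides a_i for i < r, then solve
  -- the shifted problem on windows 1 … N, shift the solution right, and repair
  -- window 0 with a multiple of the unit sequence at r; modulo q this does not
  -- disturb the later windows.
  solvable-pivot : ∀ q (r : Fin (suc d)) → InvertibleMod q (a r) →
                   (∀ i → toℕ i < toℕ r → q ℤ∣.∣ a i) → ∀ N → SolvableMod N q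
  solvable-pivot q r inv q∣low zero    F = 𝟎 , 𝟎 , λ j ()
  solvable-pivot q r (α , β , unit) q∣low (suc N) F
    with solvable-pivot q r (α , β , unit) q∣low N (λ j → F (suc j))
  ... | v , Z , h = shift v ⊕ δ ⊛ e (toℕ r) , Z′ , matches
    where
    open ≡-Reasoning
    s₀ δ : ℤ
    s₀ = S (shift v) 0
    δ  = α ℤ.* (F 0 ℤ.- s₀)
    t : ℕ → ℤ
    t j = ℤ∣._∣_.quotient (S-e-later q r q∣low j)
    Z′ : Seq
    Z′ zero    = ℤ.- ((F 0 ℤ.- s₀) ℤ.* β)
    Z′ (suc j) = Z j ℤ.- δ ℤ.* t j
    S-repaired : ∀ j → S (shift v ⊕ δ ⊛ e (toℕ r)) j ≡ S (shift v) j ℤ.+ δ ℤ.* S (e (toℕ r)) j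
    S-repaired j = trans (S-⊕ (shift v) (δ ⊛ e (toℕ r)) j) (cong (ℤ._+_ (S (shift v) j)) (S-⊛ δ (e (toℕ r)) j))
    matches : ∀ j → j < suc N → F j ≡ S (shift v ⊕ δ ⊛ e (toℕ r)) j ℤ.+ q ℤ.* Z′ j
    matches zero _ = sym (trans (cong (ℤ._+ q ℤ.* Z′ 0) (trans (S-repaired 0) (cong (λ u → s₀ ℤ.+ δ ℤ.* u) (S-e-hit 0 r))))
                                (pivot-repair s₀ (F 0) α β (a r) q unit))
    matches (suc j) (s≤s j<N) = begin
      F (suc j)                                                   ≡⟨ h j j<N ⟩
      S v j ℤ.+ q ℤ.* Z j                                         ≡⟨ split (S v j) δ (t j) q (Z j) ⟩
      S v j ℤ.+ δ ℤ.* (t j ℤ.* q) ℤ.+ q ℤ.* Z′ (suc j)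
        ≡⟨ cong (λ u → S v j ℤ.+ δ ℤ.* u ℤ.+ q ℤ.* Z′ (suc j)) (sym (ℤ∣._∣_.equality (S-e-later q r q∣low j))) ⟩
      S (shift v) (suc j) ℤ.+ δ ℤ.* S (e (toℕ r)) (suc j) ℤ.+ q ℤ.* Z′ (suc j)
        ≡⟨ cong (ℤ._+ q ℤ.* Z′ (suc j)) (sym (S-repaired (suc j))) ⟩
      S (shift v ⊕ δ ⊛ e (toℕ r)) (suc j) ℤ.+ q ℤ.* Z′ (suc j)    ∎
      where split : ∀ s δ t q z → s ℤ.+ q ℤ.* z ≡ s ℤ.+ δ ℤ.* (t ℤ.* q) ℤ.+ q ℤ.* (z ℤ.- δ ℤ.* t)
            split = solve-∀

  module _ (prim : Primitive d a) where

    -- a prime cannot divide all coefficients; the first one it misses is the pivot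
    solvable-prime : ∀ p → Prime p → ∀ N → SolvableMod N (+ p)
    solvable-prime p pr N with least-failure (suc d) (λ i → + p ℤ∣.∣ a i) (λ i → + p ℤ∣.∣? a i) ¬p∣all
      where
      ¬p∣all : ¬ (∀ i → + p ℤ∣.∣ a i)
      ¬p∣all p∣all = ℕ.nonTrivial⇒≢1 {{prime⇒nonTrivial pr}} (ℕ∣.∣1⇒≡1 (prim (+ p) (λ i → ℤ∣.∣⇒∣ᵤ (p∣all i))))
    ... | r , p∤a-r , p∣low = solvable-pivot (+ p) r (prime-invertible (a r) pr p∤a-r) p∣low N

    solvable-primes : ∀ ps → All Prime ps → ∀ N → SolvableMod N (+ product ps)
    solvable-primes []       []         N = solvable-1 N
    solvable-primes (p ∷ ps) (pr ∷ prs) N = subst (SolvableMod N) (sym (ℤP.pos-* p (product ps)))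
      (solvable-* N (+ p) (+ product ps) (solvable-prime p pr N) (solvable-primes ps prs N))

    solvable-nonzero : ∀ n → .{{ℕ.NonZero n}} → ∀ N → SolvableMod N (+ n)
    solvable-nonzero n N = subst (SolvableMod N) (cong +_ (sym (PrimeFactorisation.isFactorisation fact)))
      (solvable-primes (PrimeFactorisation.factors fact) (PrimeFactorisation.factorsPrime fact) N)
      where fact : PrimeFactorisation n
            fact = factorise n

module Exact (d : ℕ) (a : Fin (suc d) → ℤ) (prim : Primitive d a) (c≢0 : lead d a ≢ 0ℤ) where
  open Windows d a
  open Solvability d a

  c^≢0 : ∀ N → c ℤ.^ N ≢ 0ℤ
  c^≢0 N c^N≡0 = c≢0 (ℤP.i^n≡0⇒i≡0 c N c^N≡0)

  -- Triangular solving: the window at j is the first one to see position j + d,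
  -- with coefficient c.
  triangular : ∀ s N (G : Seq) → Σ Seq λ y → (∀ i → i < s ℕ.+ d → y i ≡ 0ℤ) ×
               (∀ j → s ≤ j → j < s ℕ.+ N → S y j ≡ c ℤ.^ N ℤ.* G j)
  triangular s zero G = 𝟎 , (λ _ _ → refl) , λ j s≤j j<s+0 →
    ⊥-elim (ℕP.<-irrefl refl (ℕP.<-≤-trans j<s+0 (subst (_≤ j) (sym (ℕP.+-identityʳ s)) s≤j)))
  triangular s (suc N) G with triangular s N G
  ... | y , y-low , y-hits = c ⊛ y ⊕ δ ⊛ e P , low , hits
    where
    -- scale the previous solution by c, then hit window s + N with the unit sequence at its end
    P : ℕ
    P = s ℕ.+ N ℕ.+ d
    δ : ℤ
    δ = c ℤ.^ N ℤ.* G (s ℕ.+ N) ℤ.- S y (s ℕ.+ N)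
    S-new : ∀ j → S (c ⊛ y ⊕ δ ⊛ e P) j ≡ c ℤ.* S y j ℤ.+ δ ℤ.* S (e P) j
    S-new j = trans (S-⊕ (c ⊛ y) (δ ⊛ e P) j) (cong₂ ℤ._+_ (S-⊛ c y j) (S-⊛ δ (e P) j))
    low : ∀ i → i < s ℕ.+ d → c ℤ.* y i ℤ.+ δ ℤ.* e P i ≡ 0ℤ
    low i i<s+d = cong₂ ℤ._+_ (trans (cong (c ℤ.*_) (y-low i i<s+d)) (ℤP.*-zeroʳ c))
                              (trans (cong (δ ℤ.*_) (e-off P i i≢P)) (ℤP.*-zeroʳ δ))
      where i≢P : i ≢ P
            i≢P i≡P = ℕP.<-irrefl i≡P (ℕP.<-≤-trans i<s+d (ℕP.+-monoˡ-≤ d (ℕP.m≤m+n s N)))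
    hits : ∀ j → s ≤ j → j < s ℕ.+ suc N → S (c ⊛ y ⊕ δ ⊛ e P) j ≡ c ℤ.^ suc N ℤ.* G j
    hits j s≤j j<s+N+1 with ℕP.m<1+n⇒m<n∨m≡n (subst (j <_) (ℕP.+-suc s N) j<s+N+1)
    ... | inj₁ j<s+N = begin
      S (c ⊛ y ⊕ δ ⊛ e P) j             ≡⟨ S-new j ⟩
      c ℤ.* S y j ℤ.+ δ ℤ.* S (e P) j   ≡⟨ cong₂ (λ u v → c ℤ.* u ℤ.+ δ ℤ.* v) (y-hits j s≤j j<s+N)
                                                 (S-e-before P j (ℕP.+-monoˡ-< d j<s+N)) ⟩
      c ℤ.* (c ℤ.^ N ℤ.* G j) ℤ.+ δ ℤ.* 0ℤ ≡⟨ drop c (c ℤ.^ N) (G j) δ ⟩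
      c ℤ.^ suc N ℤ.* G j               ∎
      where open ≡-Reasoning
            drop : ∀ c x g δ → c ℤ.* (x ℤ.* g) ℤ.+ δ ℤ.* 0ℤ ≡ c ℤ.* x ℤ.* g
            drop = solve-∀
    ... | inj₂ refl = trans (S-new j) (trans (cong (λ u → c ℤ.* S y j ℤ.+ δ ℤ.* u) (S-e-last j))
                                             (cancel c (c ℤ.^ N) (G j) (S y j)))
      where cancel : ∀ c x g s → c ℤ.* s ℤ.+ (x ℤ.* g ℤ.- s) ℤ.* c ≡ c ℤ.* x ℤ.* g
            cancel = solve-∀

  -- Window sums are exactly surjective on any finite range of windows: solve
  -- modulo c^N (possible since the coefficients are coprime), then absorb the
  -- error, a multiple of c^N, by triangular solving.
  exact : ∀ N (F : Seq) → Σ Seq λ v → ∀ j → j < N → S v j ≡ F j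
  exact N F with solvable-divisor N (c ℤ.^ N) (+ ∣ c ℤ.^ N ∣) ℤ∣.m∣∣m∣
                   (solvable-nonzero prim ∣ c ℤ.^ N ∣ {{nonzero}} N) F
    where nonzero : ℕ.NonZero ∣ c ℤ.^ N ∣
          nonzero = ℕ.≢-nonZero (λ eq → c^≢0 N (ℤP.∣i∣≡0⇒i≡0 eq))
  ... | v , Z , v-hits with triangular 0 N Z
  ... | y , _ , y-hits = v ⊕ y , λ j j<N →
    trans (S-⊕ v y j) (trans (cong (ℤ._+_ (S v j)) (y-hits j z≤n j<N)) (sym (v-hits j j<N)))

  module KernelBasis (n₁ : ℕ) where

    n : ℕ
    n = suc n₁

    c′ C : ℤ
    c′ = c ℤ.^ n₁
    C  = c ℤ.^ n

    record KernelElement (t : ℕ) (w : Seq) : Set where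
      field
        kernel : ∀ j → j < n → S w j ≡ 0ℤ
        low    : ∀ i → i < t ℕ.+ d → C ℤ∣.∣ w i
        pivot  : Σ ℤ λ u → w (t ℕ.+ d) ≡ u ℤ.* C ℤ.- c′

    pivot-windows : ∀ t y → (∀ i → i ≤ t ℕ.+ d → y i ≡ 0ℤ) →
                    (∀ j → t < j → j < n → S y j ≡ c′ ℤ.* S (e (t ℕ.+ d)) j) →
                    ∀ j → j < n → S (ℤ.- c′ ⊛ e (t ℕ.+ d) ⊕ y) j ≡ ℤ.- (C ℤ.* e t j)
    pivot-windows t y y-below y-late j j<n with ℕP.≤-<-connex j t
    ... | inj₁ j≤t = begin
      S (ℤ.- c′ ⊛ e (t ℕ.+ d) ⊕ y) j           ≡⟨ S-⊛⊕ (ℤ.- c′) (e (t ℕ.+ d)) y j ⟩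
      ℤ.- c′ ℤ.* S (e (t ℕ.+ d)) j ℤ.+ S y j   ≡⟨ cong₂ (λ u v → ℤ.- c′ ℤ.* u ℤ.+ v) (S-e-early t j j≤t) S-y-early ⟩
      ℤ.- c′ ℤ.* (c ℤ.* e t j) ℤ.+ 0ℤ          ≡⟨ regroup c c′ (e t j) ⟩
      ℤ.- (c ℤ.* c′ ℤ.* e t j)                 ∎
      where
      open ≡-Reasoning
      S-y-early : S y j ≡ 0ℤ
      S-y-early = S-vanish y j (λ i i≤d → y-below (j ℕ.+ i) (ℕP.+-mono-≤ j≤t i≤d))
      regroup : ∀ c x u → ℤ.- x ℤ.* (c ℤ.* u) ℤ.+ 0ℤ ≡ ℤ.- (c ℤ.* x ℤ.* u)
      regroup = solve-∀
    ... | inj₂ t<j = begin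
      S (ℤ.- c′ ⊛ e (t ℕ.+ d) ⊕ y) j                              ≡⟨ S-⊛⊕ (ℤ.- c′) (e (t ℕ.+ d)) y j ⟩
      ℤ.- c′ ℤ.* S (e (t ℕ.+ d)) j ℤ.+ S y j                      ≡⟨ cong (ℤ._+_ (ℤ.- c′ ℤ.* S (e (t ℕ.+ d)) j)) (y-late j t<j j<n) ⟩
      ℤ.- c′ ℤ.* S (e (t ℕ.+ d)) j ℤ.+ c′ ℤ.* S (e (t ℕ.+ d)) j   ≡⟨ cancel c′ (S (e (t ℕ.+ d)) j) C ⟩
      ℤ.- (C ℤ.* 0ℤ)                                              ≡⟨ cong (λ u → ℤ.- (C ℤ.* u)) (sym (e-off t j (λ eq → ℕP.<-irrefl (sym eq) t<j))) ⟩
      ℤ.- (C ℤ.* e t j)                                           ∎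
      where
      open ≡-Reasoning
      cancel : ∀ x s y → ℤ.- x ℤ.* s ℤ.+ x ℤ.* s ≡ ℤ.- (y ℤ.* 0ℤ)
      cancel = solve-∀

    -- A sequence vanishing below t + d, equal to -c′ at t + d, whose windows are
    -- -C at t and 0 at every other j < n: a multiple of the unit sequence at
    -- t + d, with its windows after t cancelled by triangular solving.
    pivotSeq : ∀ t → t < n → Σ Seq λ u → (∀ i → i < t ℕ.+ d → u i ≡ 0ℤ) × u (t ℕ.+ d) ≡ ℤ.- c′ ×
               (∀ j → j < n → S u j ≡ ℤ.- (C ℤ.* e t j))
    pivotSeq t (s≤s t≤n₁) with triangular (suc t) (n₁ ∸ t) (λ j → c ℤ.^ t ℤ.* S (e (t ℕ.+ d)) j)
    ... | y , y-low , y-hits = ℤ.- c′ ⊛ e (t ℕ.+ d) ⊕ y , low , top , pivot-windows t y y-below y-late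
      where
      y-below : ∀ i → i ≤ t ℕ.+ d → y i ≡ 0ℤ
      y-below i i≤t+d = y-low i (s≤s i≤t+d)
      low : ∀ i → i < t ℕ.+ d → ℤ.- c′ ℤ.* e (t ℕ.+ d) i ℤ.+ y i ≡ 0ℤ
      low i i<t+d = trans (cong₂ (λ u v → ℤ.- c′ ℤ.* u ℤ.+ v) (e-off _ i (λ eq → ℕP.<-irrefl eq i<t+d)) (y-below i (ℕP.<⇒≤ i<t+d)))
                          (trans (ℤP.+-identityʳ _) (ℤP.*-zeroʳ (ℤ.- c′)))
      top : ℤ.- c′ ℤ.* e (t ℕ.+ d) (t ℕ.+ d) ℤ.+ y (t ℕ.+ d) ≡ ℤ.- c′
      top = trans (cong₂ (λ u v → ℤ.- c′ ℤ.* u ℤ.+ v) (e-at (t ℕ.+ d)) (y-below (t ℕ.+ d) ℕP.≤-refl))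
                  (trans (ℤP.+-identityʳ _) (ℤP.*-identityʳ _))
      powers : c ℤ.^ (n₁ ∸ t) ℤ.* c ℤ.^ t ≡ c′
      powers = trans (sym (ℤP.^-distribˡ-+-* c (n₁ ∸ t) t)) (cong (c ℤ.^_) (ℕP.m∸n+n≡m t≤n₁))
      y-late : ∀ j → t < j → j < n → S y j ≡ c′ ℤ.* S (e (t ℕ.+ d)) j
      y-late j t<j j<n = trans (y-hits j t<j j<t+1+[n₁-t])
                           (trans (sym (ℤP.*-assoc (c ℤ.^ (n₁ ∸ t)) (c ℤ.^ t) _)) (cong (ℤ._* S (e (t ℕ.+ d)) j) powers))
        where j<t+1+[n₁-t] : j < suc t ℕ.+ (n₁ ∸ t)
              j<t+1+[n₁-t] = subst (j <_) (cong suc (sym (trans (ℕP.+-comm t (n₁ ∸ t)) (ℕP.m∸n+n≡m t≤n₁)))) j<n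

    kernelElement : ∀ t → t < n → Σ Seq (KernelElement t)
    kernelElement t t<n = C ⊛ v ⊕ u , record
      { kernel = λ j j<n → begin
          S (C ⊛ v ⊕ u) j            ≡⟨ S-⊕ (C ⊛ v) u j ⟩
          S (C ⊛ v) j ℤ.+ S u j      ≡⟨ cong₂ ℤ._+_ (trans (S-⊛ C v j) (cong (C ℤ.*_) (v-hits j j<n))) (u-windows j j<n) ⟩
          C ℤ.* e t j ℤ.+ ℤ.- (C ℤ.* e t j) ≡⟨ ℤP.+-inverseʳ (C ℤ.* e t j) ⟩
          0ℤ                         ∎
      ; low = λ i i<t+d → divides (v i) (trans (cong (ℤ._+_ (C ℤ.* v i)) (u-low i i<t+d))
                                               (trans (ℤP.+-identityʳ _) (ℤP.*-comm C (v i))))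
      ; pivot = v (t ℕ.+ d) , trans (cong (ℤ._+_ (C ℤ.* v (t ℕ.+ d))) u-top)
                                    (cong (ℤ._- c′) (ℤP.*-comm C (v (t ℕ.+ d))))
      }
      where
      open ≡-Reasoning
      v : Seq
      v = proj₁ (exact n (e t))
      v-hits : ∀ j → j < n → S v j ≡ e t j
      v-hits = proj₂ (exact n (e t))
      u : Seq
      u = proj₁ (pivotSeq t t<n)
      u-low : ∀ i → i < t ℕ.+ d → u i ≡ 0ℤ
      u-low = proj₁ (proj₂ (pivotSeq t t<n))
      u-top : u (t ℕ.+ d) ≡ ℤ.- c′
      u-top = proj₁ (proj₂ (proj₂ (pivotSeq t t<n)))
      u-windows : ∀ j → j < n → S u j ≡ ℤ.- (C ℤ.* e t j)
      u-windows = proj₂ (proj₂ (proj₂ (pivotSeq t t<n)))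

digit-unique : ∀ (c : ℤ) (x y : ℕ) → x < ∣ c ∣ → y < ∣ c ∣ → c ℤ∣.∣ (+ x ℤ.- + y) → x ≡ y
digit-unique c x y x<c y<c (divides k x-y≡kc) =
  ℤP.+-injective (ℤP.i-j≡0⇒i≡j (+ x) (+ y) (trans x-y≡kc (trans (cong (ℤ._* c) k≡0) (ℤP.*-zeroˡ c))))
  where
  ∣x-y∣<∣c∣ : ∣ + x ℤ.- + y ∣ < ∣ c ∣
  ∣x-y∣<∣c∣ with ℕP.≤-total x y
  ... | inj₁ x≤y = subst (_< ∣ c ∣) (sym (trans (cong ∣_∣ (ℤP.m-n≡m⊖n x y)) (ℤP.∣⊖∣-≤ x≤y)))
                         (ℕP.≤-<-trans (ℕP.m∸n≤m y x) y<c)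
  ... | inj₂ y≤x = subst (_< ∣ c ∣) (sym (trans (cong ∣_∣ (ℤP.m-n≡m⊖n x y)) (trans (ℤP.∣m⊖n∣≡∣n⊖m∣ x y) (ℤP.∣⊖∣-≤ y≤x))))
                         (ℕP.≤-<-trans (ℕP.m∸n≤m x y) x<c)
  k≡0 : k ≡ 0ℤ
  k≡0 with ∣ k ∣ ℕ.≟ 0
  ... | yes ∣k∣≡0 = ℤP.∣i∣≡0⇒i≡0 ∣k∣≡0
  ... | no  ∣k∣≢0 = ⊥-elim (ℕP.<-irrefl refl (ℕP.<-≤-trans
          (subst (_< ∣ c ∣) (trans (cong ∣_∣ x-y≡kc) (ℤP.abs-* k c)) ∣x-y∣<∣c∣)
          (ℕP.m≤n*m ∣ c ∣ ∣ k ∣ {{ℕ.≢-nonZero ∣k∣≢0}})))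

digit-exists : ∀ (c : ℤ) .{{_ : ℤ.NonZero c}} (q : ℤ) → Σ (Fin ∣ c ∣) λ l → c ℤ∣.∣ (q ℤ.+ + toℕ l)
digit-exists c q = fromℕ< r<∣c∣ , divides (ℤ.- (ℤ.- q ℤD./ c)) (begin
  q ℤ.+ + toℕ (fromℕ< r<∣c∣)               ≡⟨ cong (λ r → q ℤ.+ + r) (FinP.toℕ-fromℕ< r<∣c∣) ⟩
  q ℤ.+ + (ℤ.- q ℤD.% c)                   ≡⟨ negate q (+ (ℤ.- q ℤD.% c)) ⟩
  ℤ.- (ℤ.- q ℤ.- + (ℤ.- q ℤD.% c))         ≡⟨ cong (λ z → ℤ.- (z ℤ.- + (ℤ.- q ℤD.% c))) (ℤD.a≡a%n+[a/n]*n (ℤ.- q) c) ⟩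
  ℤ.- (+ (ℤ.- q ℤD.% c) ℤ.+ (ℤ.- q ℤD./ c) ℤ.* c ℤ.- + (ℤ.- q ℤD.% c))
                                           ≡⟨ collect (+ (ℤ.- q ℤD.% c)) (ℤ.- q ℤD./ c) c ⟩
  ℤ.- (ℤ.- q ℤD./ c) ℤ.* c                 ∎)
  where
  open ≡-Reasoning
  r<∣c∣ : ℤ.- q ℤD.% c < ∣ c ∣
  r<∣c∣ = ℤD.n%d<d (ℤ.- q) c
  negate : ∀ q r → q ℤ.+ r ≡ ℤ.- (ℤ.- q ℤ.- r)
  negate = solve-∀
  collect : ∀ r k c → ℤ.- (r ℤ.+ k ℤ.* c ℤ.- r) ≡ ℤ.- k ℤ.* c
  collect = solve-∀

infixl 6 _⊝_

_⊝_ : Seq → Seq → Seq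
v ⊝ w = v ⊕ -1ℤ ⊛ w

record Closed (P : Seq → Set) : Set where
  field
    𝟎∈ : P 𝟎
    ⊕∈ : ∀ {v w} → P v → P w → P (v ⊕ w)
    ⊛∈ : ∀ k {v} → P v → P (k ⊛ v)

  ⊝∈ : ∀ {v w} → P v → P w → P (v ⊝ w)
  ⊝∈ pv pw = ⊕∈ pv (⊛∈ -1ℤ pw)

Low : ℤ → ℕ → Seq → Set
Low C k X = ∀ i → i < k → C ℤ∣.∣ X i

low-closed : ∀ C k → Closed (Low C k)
low-closed C k = record
  { 𝟎∈ = λ i _ → divides 0ℤ refl
  ; ⊕∈ = λ lv lw i i<k → ℤ∣.∣m∣n⇒∣m+n (lv i i<k) (lw i i<k)
  ; ⊛∈ = λ r lv i i<k → ℤ∣.∣n⇒∣m*n r (lv i i<k)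
  }

low-cong : ∀ {C k X Y} → (∀ i → X i ≡ Y i) → Low C k X → Low C k Y
low-cong X≗Y low i i<k = subst (_ ℤ∣.∣_) (X≗Y i) (low i i<k)

low-mono : ∀ {C k k′ X} → k ≤ k′ → Low C k′ X → Low C k X
low-mono k≤k′ low i i<k = low i (ℕP.<-≤-trans i<k k≤k′)

low-extend : ∀ {C k X} → Low C k X → C ℤ∣.∣ X k → Low C (suc k) X
low-extend low top i i<k+1 with ℕP.m<1+n⇒m<n∨m≡n i<k+1
... | inj₁ i<k  = low i i<k
... | inj₂ refl = top

comb : ∀ {b k} → (Fin k → Fin b) → (Fin k → Seq) → Seq
comb l fam i = sum (λ t → + toℕ (l t) ℤ.* fam t i)

comb-closed : ∀ {P b} → Closed P → ∀ {k} (l : Fin k → Fin b) (fam : Fin k → Seq) →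
              (∀ t → P (fam t)) → P (comb l fam)
comb-closed P-closed {zero}  l fam h = Closed.𝟎∈ P-closed
comb-closed P-closed {suc k} l fam h =
  Closed.⊕∈ P-closed (Closed.⊛∈ P-closed (+ toℕ (l Fin.zero)) (h Fin.zero))
                     (comb-closed P-closed (l ∘ Fin.suc) (fam ∘ Fin.suc) (h ∘ Fin.suc))

comb-cong : ∀ {b k} {l l′ : Fin k → Fin b} (fam : Fin k → Seq) → (∀ t → l t ≡ l′ t) →
            ∀ i → comb l fam i ≡ comb l′ fam i
comb-cong fam l≗l′ i = sum-cong-≗ (λ t → cong (λ x → + toℕ x ℤ.* fam t i) (l≗l′ t))

funToFin-cong : ∀ {m n} (f g : Fin m → Fin n) → (∀ i → f i ≡ g i) → funToFin f ≡ funToFin g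
funToFin-cong {zero}  f g f≗g = refl
funToFin-cong {suc m} f g f≗g = cong₂ Fin.combine (f≗g Fin.zero) (funToFin-cong (f ∘ Fin.suc) (g ∘ Fin.suc) (f≗g ∘ Fin.suc))

-- The kernel of the first n windows modulo C = c^n has the digit combinations
-- of the kernel elements w_0, …, w_{n-1} as a complete irredundant system of
-- representatives on positions [0, n + d): position t + d is reduced by w_t.
module Digits (d : ℕ) (a : Fin (suc d) → ℤ) (prim : Primitive d a) (c≢0 : lead d a ≢ 0ℤ) (n₁ : ℕ) where
  open Windows d a
  open Exact d a prim c≢0
  open KernelBasis n₁

  instance
    c-nonzero : ℤ.NonZero c
    c-nonzero = ℤ.≢-nonZero c≢0
    c′-nonzero : ℤ.NonZero c′
    c′-nonzero = ℤ.≢-nonZero (c^≢0 n₁)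

  b : ℕ
  b = ∣ c ∣

  Kernel : Seq → Set
  Kernel X = ∀ j → j < n → S X j ≡ 0ℤ

  kernel-closed : Closed Kernel
  kernel-closed = record
    { 𝟎∈ = λ j _ → S-vanish 𝟎 j (λ _ _ → refl)
    ; ⊕∈ = λ {v} {w} kv kw j j<n → trans (S-⊕ v w j) (cong₂ ℤ._+_ (kv j j<n) (kw j j<n))
    ; ⊛∈ = λ r {v} kv j j<n → trans (S-⊛ r v j) (trans (cong (r ℤ.*_) (kv j j<n)) (ℤP.*-zeroʳ r))
    }

  -- In a kernel sequence that is ≡ 0 mod C below t + d, window t forces
  -- c·X_{t+d} ≡ 0 mod C = c·c′, i.e. c′ divides X_{t+d}.
  window-top : ∀ X t → Kernel X → t < n → Low C (t ℕ.+ d) X → c′ ℤ∣.∣ X (t ℕ.+ d)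
  window-top X t kernel t<n low = ℤ∣.*-cancelˡ-∣ c c·c′∣c·X
    where
    f : Fin (suc d) → ℤ
    f i = a i ℤ.* X (t ℕ.+ toℕ i)
    earlier : ∀ i → i ≢ fromℕ d → C ℤ∣.∣ f i
    earlier i i≢d = ℤ∣.∣n⇒∣m*n (a i) (low _ (ℕP.+-monoʳ-< t (ℕP.≤∧≢⇒< (ℕP.≤-pred (FinP.toℕ<n i))
                      (λ eq → i≢d (FinP.toℕ-injective (trans eq (sym (FinP.toℕ-fromℕ d))))))))
    last : C ℤ∣.∣ f (fromℕ d)
    last = sum-except (multiples C) d f (fromℕ d) earlier (subst (C ℤ∣.∣_) (sym (kernel t t<n)) (divides 0ℤ refl))
    c·c′∣c·X : c ℤ.* c′ ℤ∣.∣ c ℤ.* X (t ℕ.+ d)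
    c·c′∣c·X = subst (λ s → C ℤ∣.∣ c ℤ.* X (t ℕ.+ s)) (FinP.toℕ-fromℕ d) last

  -- The pivot entry of w_t is a unit times c′ modulo C, so it detects digits modulo c.
  pivot-detects : ∀ {t w} → KernelElement t w → ∀ k → C ℤ∣.∣ k ℤ.* w (t ℕ.+ d) → c ℤ∣.∣ k
  pivot-detects {t} {w} K k C∣kw with KernelElement.pivot K
  ... | u , w≡uC-c′ = ℤ∣.*-cancelʳ-∣ c′ (subst (C ℤ∣.∣_) (drop k u c c′) C∣kuC-kw)
    where
    C∣kuC-kw : C ℤ∣.∣ k ℤ.* u ℤ.* C ℤ.- k ℤ.* (u ℤ.* C ℤ.- c′)
    C∣kuC-kw = ℤ∣.∣m∣n⇒∣m-n (ℤ∣.∣n⇒∣m*n (k ℤ.* u) (ℤ∣.∣-refl {C})) (subst (λ z → C ℤ∣.∣ k ℤ.* z) w≡uC-c′ C∣kw)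
    drop : ∀ k u c x → k ℤ.* u ℤ.* (c ℤ.* x) ℤ.- k ℤ.* (u ℤ.* (c ℤ.* x) ℤ.- x) ≡ k ℤ.* x
    drop = solve-∀

  Family : ℕ → ∀ k → (Fin k → Seq) → Set
  Family t₀ k fam = ∀ t → KernelElement (t₀ ℕ.+ toℕ t) (fam t)

  family-head : ∀ {t₀ k fam} → Family t₀ (suc k) fam → KernelElement t₀ (fam Fin.zero)
  family-head {t₀} {k} {fam} F = subst (λ s → KernelElement s (fam Fin.zero)) (ℕP.+-identityʳ t₀) (F Fin.zero)

  family-tail : ∀ {t₀ k fam} → Family t₀ (suc k) fam → Family (suc t₀) k (fam ∘ Fin.suc)
  family-tail {t₀} {k} {fam} F t = subst (λ s → KernelElement s (fam (Fin.suc t))) (ℕP.+-suc t₀ (toℕ t)) (F (Fin.suc t))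

  family-low : ∀ {t₀ k fam} → Family t₀ k fam → ∀ t → Low C (t₀ ℕ.+ d) (fam t)
  family-low {t₀} F t = low-mono (ℕP.+-monoˡ-≤ d (ℕP.m≤m+n t₀ (toℕ t))) (KernelElement.low (F t))

  reduce : ∀ t w → KernelElement t w → t < n → ∀ X → Kernel X → Low C (t ℕ.+ d) X →
           Σ (Fin b) λ l₀ → Kernel (X ⊝ + toℕ l₀ ⊛ w) × Low C (suc t ℕ.+ d) (X ⊝ + toℕ l₀ ⊛ w)
  reduce t w K t<n X kernel low = l₀ , kernel′ , low-extend low′ (top (KernelElement.pivot K))
    where
    open ≡-Reasoning
    c′∣X : c′ ℤ∣.∣ X (t ℕ.+ d)
    c′∣X = window-top X t kernel t<n low
    q : ℤ
    q = ℤ∣._∣_.quotient c′∣X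
    l₀ : Fin b
    l₀ = proj₁ (digit-exists c q)
    c∣q+l₀ : c ℤ∣.∣ (q ℤ.+ + toℕ l₀)
    c∣q+l₀ = proj₂ (digit-exists c q)
    kernel′ : Kernel (X ⊝ + toℕ l₀ ⊛ w)
    kernel′ = Closed.⊝∈ kernel-closed {X} {+ toℕ l₀ ⊛ w} kernel (Closed.⊛∈ kernel-closed (+ toℕ l₀) {w} (KernelElement.kernel K))
    low′ : Low C (t ℕ.+ d) (X ⊝ + toℕ l₀ ⊛ w)
    low′ = Closed.⊝∈ (low-closed C _) {X} {+ toℕ l₀ ⊛ w} low (Closed.⊛∈ (low-closed C _) (+ toℕ l₀) {w} (KernelElement.low K))
    -- X_{t+d} - l₀·w_{t+d} ≡ (q + l₀)·c′ ≡ 0 modulo C = c·c′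
    top : Σ ℤ (λ u → w (t ℕ.+ d) ≡ u ℤ.* C ℤ.- c′) → C ℤ∣.∣ (X ⊝ + toℕ l₀ ⊛ w) (t ℕ.+ d)
    top (u , w≡uC-c′) = divides (s ℤ.- + toℕ l₀ ℤ.* u) (begin
      X (t ℕ.+ d) ℤ.+ -1ℤ ℤ.* (+ toℕ l₀ ℤ.* w (t ℕ.+ d))
        ≡⟨ cong₂ (λ x y → x ℤ.+ -1ℤ ℤ.* (+ toℕ l₀ ℤ.* y)) (ℤ∣._∣_.equality c′∣X) w≡uC-c′ ⟩
      q ℤ.* c′ ℤ.+ -1ℤ ℤ.* (+ toℕ l₀ ℤ.* (u ℤ.* (c ℤ.* c′) ℤ.- c′))
        ≡⟨ regroup q (+ toℕ l₀) u c c′ ⟩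
      (q ℤ.+ + toℕ l₀) ℤ.* c′ ℤ.- + toℕ l₀ ℤ.* u ℤ.* (c ℤ.* c′)
        ≡⟨ cong (λ x → x ℤ.* c′ ℤ.- + toℕ l₀ ℤ.* u ℤ.* (c ℤ.* c′)) (ℤ∣._∣_.equality c∣q+l₀) ⟩
      s ℤ.* c ℤ.* c′ ℤ.- + toℕ l₀ ℤ.* u ℤ.* (c ℤ.* c′)
        ≡⟨ factor s (+ toℕ l₀ ℤ.* u) c c′ ⟩
      (s ℤ.- + toℕ l₀ ℤ.* u) ℤ.* (c ℤ.* c′) ∎)
      where
      s : ℤ
      s = ℤ∣._∣_.quotient c∣q+l₀
      regroup : ∀ q l u c x → q ℤ.* x ℤ.+ -1ℤ ℤ.* (l ℤ.* (u ℤ.* (c ℤ.* x) ℤ.- x))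
                            ≡ (q ℤ.+ l) ℤ.* x ℤ.- l ℤ.* u ℤ.* (c ℤ.* x)
      regroup = solve-∀
      factor : ∀ s v c x → s ℤ.* c ℤ.* x ℤ.- v ℤ.* (c ℤ.* x) ≡ (s ℤ.- v) ℤ.* (c ℤ.* x)
      factor = solve-∀

  cover : ∀ k t₀ (fam : Fin k → Seq) → Family t₀ k fam → t₀ ℕ.+ k ≤ n →
          ∀ X → Kernel X → Low C (t₀ ℕ.+ d) X →
          Σ (Fin k → Fin b) λ l → Low C (t₀ ℕ.+ k ℕ.+ d) (X ⊝ comb l fam)
  cover zero t₀ fam F bound X kernel low =
    (λ ()) , low-cong (λ i → sym (trans (cong (ℤ._+_ (X i)) (ℤP.*-zeroʳ -1ℤ)) (ℤP.+-identityʳ (X i))))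
                      (subst (λ s → Low C (s ℕ.+ d) X) (sym (ℕP.+-identityʳ t₀)) low)
  cover (suc k) t₀ fam F bound X kernel low =
    digits , subst (λ s → Low C (s ℕ.+ d) (X ⊝ comb digits fam)) (sym (ℕP.+-suc t₀ k)) (low-cong same (proj₂ rest))
    where
    step : Σ (Fin b) λ l₀ → Kernel (X ⊝ + toℕ l₀ ⊛ fam Fin.zero) × Low C (suc t₀ ℕ.+ d) (X ⊝ + toℕ l₀ ⊛ fam Fin.zero)
    step = reduce t₀ (fam Fin.zero) (family-head F) (ℕP.<-≤-trans (ℕP.m<m+n t₀ (s≤s z≤n)) bound) X kernel low
    l₀ : Fin b
    l₀ = proj₁ step
    rest : Σ (Fin k → Fin b) λ l → Low C (suc t₀ ℕ.+ k ℕ.+ d) (X ⊝ + toℕ l₀ ⊛ fam Fin.zero ⊝ comb l (fam ∘ Fin.suc))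
    rest = cover k (suc t₀) (fam ∘ Fin.suc) (family-tail F) (subst (_≤ n) (ℕP.+-suc t₀ k) bound)
                 (X ⊝ + toℕ l₀ ⊛ fam Fin.zero) (proj₁ (proj₂ step)) (proj₂ (proj₂ step))
    digits : Fin (suc k) → Fin b
    digits Fin.zero    = l₀
    digits (Fin.suc t) = proj₁ rest t
    same : ∀ i → (X ⊝ + toℕ l₀ ⊛ fam Fin.zero ⊝ comb (proj₁ rest) (fam ∘ Fin.suc)) i ≡ (X ⊝ comb digits fam) i
    same i = regroup (X i) (+ toℕ l₀ ℤ.* fam Fin.zero i) (comb (proj₁ rest) (fam ∘ Fin.suc) i)
      where regroup : ∀ x y z → x ℤ.+ -1ℤ ℤ.* y ℤ.+ -1ℤ ℤ.* z ≡ x ℤ.+ -1ℤ ℤ.* (y ℤ.+ z)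
            regroup = solve-∀

  -- Irredundancy: two digit combinations agreeing modulo C have the same digits;
  -- at position t₀ + d only w_{t₀} contributes modulo C.
  irredundant : ∀ k t₀ (fam : Fin k → Seq) → Family t₀ k fam → (l l′ : Fin k → Fin b) →
                Low C (t₀ ℕ.+ k ℕ.+ d) (comb l fam ⊝ comb l′ fam) → ∀ t → l t ≡ l′ t
  irredundant zero    t₀ fam F l l′ low ()
  irredundant (suc k) t₀ fam F l l′ low = same-digits
    where
    p : ℕ
    p = t₀ ℕ.+ d
    w₀ : Seq
    w₀ = fam Fin.zero
    L : ℤ
    L = + toℕ (l Fin.zero) ℤ.- + toℕ (l′ Fin.zero)
    rest rest′ : Seq
    rest  = comb (l ∘ Fin.suc) (fam ∘ Fin.suc)
    rest′ = comb (l′ ∘ Fin.suc) (fam ∘ Fin.suc)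
    tail-low : ∀ (m : Fin k → Fin b) → Low C (suc p) (comb m (fam ∘ Fin.suc))
    tail-low m = comb-closed (low-closed C _) m (fam ∘ Fin.suc) (family-low (family-tail F))
    C∣Lw₀ : C ℤ∣.∣ L ℤ.* w₀ p
    C∣Lw₀ = subst (C ℤ∣.∣_) (isolate (+ toℕ (l Fin.zero)) (+ toℕ (l′ Fin.zero)) (w₀ p) (rest p) (rest′ p))
      (ℤ∣.∣m∣n⇒∣m-n (low p (ℕP.+-monoˡ-< d (ℕP.m<m+n t₀ (s≤s z≤n))))
                    (ℤ∣.∣m∣n⇒∣m-n (tail-low (l ∘ Fin.suc) p (ℕP.n<1+n p)) (tail-low (l′ ∘ Fin.suc) p (ℕP.n<1+n p))))
      where isolate : ∀ x y f r r′ → x ℤ.* f ℤ.+ r ℤ.+ -1ℤ ℤ.* (y ℤ.* f ℤ.+ r′) ℤ.- (r ℤ.- r′) ≡ (x ℤ.- y) ℤ.* f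
            isolate = solve-∀
    head-same : l Fin.zero ≡ l′ Fin.zero
    head-same = FinP.toℕ-injective (digit-unique c _ _ (FinP.toℕ<n _) (FinP.toℕ<n _)
                  (pivot-detects (family-head F) L C∣Lw₀))
    tail-low′ : Low C (suc t₀ ℕ.+ k ℕ.+ d) (rest ⊝ rest′)
    tail-low′ = subst (λ s → Low C (s ℕ.+ d) (rest ⊝ rest′)) (ℕP.+-suc t₀ k) (low-cong drop-head low)
      where
      drop-head : ∀ i → (comb l fam ⊝ comb l′ fam) i ≡ (rest ⊝ rest′) i
      drop-head i = trans (cong (λ x → + toℕ (l Fin.zero) ℤ.* w₀ i ℤ.+ rest i ℤ.+ -1ℤ ℤ.* (+ toℕ x ℤ.* w₀ i ℤ.+ rest′ i)) (sym head-same))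
                          (cancel (+ toℕ (l Fin.zero) ℤ.* w₀ i) (rest i) (rest′ i))
        where cancel : ∀ x r r′ → x ℤ.+ r ℤ.+ -1ℤ ℤ.* (x ℤ.+ r′) ≡ r ℤ.+ -1ℤ ℤ.* r′
              cancel = solve-∀
    same-digits : ∀ t → l t ≡ l′ t
    same-digits Fin.zero    = head-same
    same-digits (Fin.suc t) = irredundant k (suc t₀) (fam ∘ Fin.suc) (family-tail F) (l ∘ Fin.suc) (l′ ∘ Fin.suc) tail-low′ t

ιᵘ : ∀ z → ℚ.toℚᵘ (ι z) ℚᵘ.≃ ℚᵘ.mkℚᵘ z 0
ιᵘ z = ℚP.toℚᵘ-fromℚᵘ (ℚᵘ.mkℚᵘ z 0)

ι-+ : ∀ x y → ι (x ℤ.+ y) ≡ ι x ℚ.+ ι y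
ι-+ x y = ℚP.toℚᵘ-injective (begin
  ℚ.toℚᵘ (ι (x ℤ.+ y))            ≈⟨ ιᵘ (x ℤ.+ y) ⟩
  ℚᵘ.mkℚᵘ (x ℤ.+ y) 0             ≈⟨ ℚᵘ.*≡* (unit-denominators x y) ⟩
  ℚᵘ.mkℚᵘ x 0 ℚᵘ.+ ℚᵘ.mkℚᵘ y 0    ≈⟨ ℚᵘP.+-cong (ℚᵘP.≃-sym (ιᵘ x)) (ℚᵘP.≃-sym (ιᵘ y)) ⟩
  ℚ.toℚᵘ (ι x) ℚᵘ.+ ℚ.toℚᵘ (ι y)  ≈⟨ ℚᵘP.≃-sym (ℚP.toℚᵘ-homo-+ (ι x) (ι y)) ⟩
  ℚ.toℚᵘ (ι x ℚ.+ ι y)            ∎)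
  where
  open import Relation.Binary.Reasoning.Setoid ℚᵘP.≃-setoid
  unit-denominators : ∀ x y → (x ℤ.+ y) ℤ.* + 1 ≡ (x ℤ.* + 1 ℤ.+ y ℤ.* + 1) ℤ.* + 1
  unit-denominators = solve-∀

ι-* : ∀ x y → ι (x ℤ.* y) ≡ ι x ℚ.* ι y
ι-* x y = ℚP.toℚᵘ-injective (begin
  ℚ.toℚᵘ (ι (x ℤ.* y))            ≈⟨ ιᵘ (x ℤ.* y) ⟩
  ℚᵘ.mkℚᵘ (x ℤ.* y) 0             ≈⟨ ℚᵘP.≃-refl ⟩
  ℚᵘ.mkℚᵘ x 0 ℚᵘ.* ℚᵘ.mkℚᵘ y 0    ≈⟨ ℚᵘP.*-cong (ℚᵘP.≃-sym (ιᵘ x)) (ℚᵘP.≃-sym (ιᵘ y)) ⟩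
  ℚ.toℚᵘ (ι x) ℚᵘ.* ℚ.toℚᵘ (ι y)  ≈⟨ ℚᵘP.≃-sym (ℚP.toℚᵘ-homo-* (ι x) (ι y)) ⟩
  ℚ.toℚᵘ (ι x ℚ.* ι y)            ∎)
  where open import Relation.Binary.Reasoning.Setoid ℚᵘP.≃-setoid

ι-neg : ∀ x → ι (ℤ.- x) ≡ ℚ.- ι x
ι-neg x = ℚP.toℚᵘ-injective (ℚᵘP.≃-trans (ιᵘ (ℤ.- x))
            (ℚᵘP.≃-trans (ℚᵘP.-‿cong (ℚᵘP.≃-sym (ιᵘ x))) (ℚᵘP.≃-sym (ℚP.toℚᵘ-homo‿- (ι x)))))

ι-injective : ∀ {x y} → ι x ≡ ι y → x ≡ y
ι-injective {x} {y} eq with ℚᵘP.≃-trans (ℚᵘP.≃-sym (ιᵘ x)) (ℚᵘP.≃-trans (ℚP.toℚᵘ-cong eq) (ιᵘ y))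
... | ℚᵘ.*≡* x*1≡y*1 = trans (sym (ℤP.*-identityʳ x)) (trans x*1≡y*1 (ℤP.*-identityʳ y))

ι-sum : ∀ n (f : Fin n → ℤ) → ι (sum f) ≡ sumℚ n (ι ∘ f)
ι-sum zero    f = refl
ι-sum (suc n) f = trans (ι-+ (f Fin.zero) _) (cong (ι (f Fin.zero) ℚ.+_) (ι-sum n (f ∘ Fin.suc)))

sumℚ-cong : ∀ n {f g : Fin n → ℚ} → (∀ i → f i ≡ g i) → sumℚ n f ≡ sumℚ n g
sumℚ-cong zero    f≗g = refl
sumℚ-cong (suc n) f≗g = cong₂ ℚ._+_ (f≗g Fin.zero) (sumℚ-cong n (f≗g ∘ Fin.suc))

sumℚ-scale : ∀ n (k : ℚ) (f : Fin n → ℚ) → sumℚ n (λ i → k ℚ.* f i) ≡ k ℚ.* sumℚ n f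
sumℚ-scale zero    k f = sym (ℚP.*-zeroʳ k)
sumℚ-scale (suc n) k f = trans (cong (k ℚ.* f Fin.zero ℚ.+_) (sumℚ-scale n k (f ∘ Fin.suc)))
                               (sym (ℚP.*-distribˡ-+ k (f Fin.zero) _))

module ℚ-Sums = SubgroupSums ℚP.+-0-abelianGroup

sumℚ≡∑ : ∀ n (f : Fin n → ℚ) → sumℚ n f ≡ ℚ-Sums.∑ f
sumℚ≡∑ zero    f = refl
sumℚ≡∑ (suc n) f = cong (f Fin.zero ℚ.+_) (sumℚ≡∑ n (f ∘ Fin.suc))

integers : ℚ-Sums.IsSubgroup IsInt
integers = record
  { respects  = λ eq → subst IsInt eq
  ; ε-closed  = 0ℤ , refl
  ; ∙-closed  = λ { (z , refl) (w , refl) → z ℤ.+ w , sym (ι-+ z w) }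
  ; ⁻¹-closed = λ { (z , refl) → ℤ.- z , sym (ι-neg z) }
  }

at-lt : ∀ {m} (x : Fin m → ℚ) k (k<m : k < m) → at x k ≡ x (fromℕ< k<m)
at-lt {m} x k k<m with k <? m
... | yes _   = refl
... | no  k≮m = ⊥-elim (k≮m k<m)

integer-part : ∀ m (y : ℕ → ℚ) → (∀ p → p < m → IsInt (y p)) → Σ Seq λ Y → ∀ p → p < m → y p ≡ ι (Y p)
integer-part m y int = Y , spec
  where
  Y : Seq
  Y p with p <? m
  ... | yes p<m = proj₁ (int p p<m)
  ... | no  _   = 0ℤ
  spec : ∀ p → p < m → y p ≡ ι (Y p)
  spec p p<m with p <? m
  ... | yes p<m′ = proj₂ (int p p<m′)
  ... | no  p≮m  = ⊥-elim (p≮m p<m)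

-- Rational vectors with denominator dividing C, represented by the integer sequence of their numerators.
module Scaling (d : ℕ) (a : Fin (suc d) → ℤ) {m : ℕ} (C : ℤ) (C≢0 : C ≢ 0ℤ) where
  open Windows d a

  instance
    ιC-nonzero : ℚ.NonZero (ι C)
    ιC-nonzero = ℚ.≢-nonZero (λ ιC≡0 → C≢0 (ι-injective ιC≡0))

  record _Represents_ (X : Seq) (x : Fin m → ℚ) : Set where
    constructor represents
    field entry : ∀ i → ι (X (toℕ i)) ≡ ι C ℚ.* x i
  open _Represents_

  ιC-cancel : ∀ {p q} → ι C ℚ.* p ≡ ι C ℚ.* q → p ≡ q
  ιC-cancel {p} {q} eq = trans (sym (unscale p)) (trans (cong (1/ιC ℚ.*_) eq) (unscale q))
    where
    1/ιC : ℚ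
    1/ιC = ℚ.1/ ι C
    unscale : ∀ r → 1/ιC ℚ.* (ι C ℚ.* r) ≡ r
    unscale r = trans (sym (ℚP.*-assoc 1/ιC (ι C) r)) (trans (cong (ℚ._* r) (ℚP.*-inverseˡ (ι C))) (ℚP.*-identityˡ r))

  divide : ∀ X → X Represents (λ i → ι (X (toℕ i)) ℚ.* ℚ.1/ ι C)
  divide X = represents λ i → sym (trans (ℚP.*-comm (ι C) _) (trans (ℚP.*-assoc (ι (X (toℕ i))) (ℚ.1/ ι C) (ι C))
               (trans (cong (ι (X (toℕ i)) ℚ.*_) (ℚP.*-inverseˡ (ι C))) (ℚP.*-identityʳ _))))

  represents-⊝ : ∀ {X Y x y} → X Represents x → Y Represents y → (X ⊝ Y) Represents (x ⊖ y)
  represents-⊝ {X} {Y} {x} {y} X≈x Y≈y = represents λ i → begin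
    ι (X (toℕ i) ℤ.+ -1ℤ ℤ.* Y (toℕ i))          ≡⟨ ι-+ (X (toℕ i)) _ ⟩
    ι (X (toℕ i)) ℚ.+ ι (-1ℤ ℤ.* Y (toℕ i))      ≡⟨ cong (ι (X (toℕ i)) ℚ.+_) (trans (cong ι (ℤP.-1*i≡-i (Y (toℕ i)))) (ι-neg (Y (toℕ i)))) ⟩
    ι (X (toℕ i)) ℚ.- ι (Y (toℕ i))              ≡⟨ cong₂ ℚ._-_ (entry X≈x i) (entry Y≈y i) ⟩
    ι C ℚ.* x i ℚ.- ι C ℚ.* y i                  ≡⟨ factor (ι C) (x i) (y i) ⟩
    ι C ℚ.* (x i ℚ.- y i)                        ∎
    where
    open ≡-Reasoning
    factor : ∀ c u v → c ℚ.* u ℚ.- c ℚ.* v ≡ c ℚ.* (u ℚ.- v)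
    factor = solve 3 (λ c u v → c :* u :- c :* v := c :* (u :- v)) refl

  represents-int : ∀ {X x} → X Represents x → ∀ i → C ℤ∣.∣ X (toℕ i) → IsInt (x i)
  represents-int X≈x i (divides q X≡qC) =
    q , ιC-cancel (trans (sym (entry X≈x i)) (trans (cong ι (trans X≡qC (ℤP.*-comm q C))) (ι-* C q)))

  represents-int⁻¹ : ∀ {X x} → X Represents x → ∀ i → IsInt (x i) → C ℤ∣.∣ X (toℕ i)
  represents-int⁻¹ X≈x i (z , x≡ιz) =
    divides z (trans (ι-injective (trans (entry X≈x i) (trans (cong (ι C ℚ.*_) x≡ιz) (sym (ι-* C z))))) (ℤP.*-comm C z))

  represents-at : ∀ {X x} → X Represents x → ∀ p → p < m → ι (X p) ≡ ι C ℚ.* at x p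
  represents-at {X} {x} X≈x p p<m = trans (cong (ι ∘ X) (sym (FinP.toℕ-fromℕ< p<m)))
                                          (trans (entry X≈x (fromℕ< p<m)) (cong (ι C ℚ.*_) (sym (at-lt x p p<m))))

  window-scale : ∀ {X x} → X Represents x → ∀ j → j ℕ.+ d < m →
                 ι (S X j) ≡ ι C ℚ.* sumℚ (suc d) (λ i → ι (a i) ℚ.* at x (j ℕ.+ toℕ i))
  window-scale {X} {x} X≈x j j+d<m = begin
    ι (S X j)                                                       ≡⟨ ι-sum (suc d) (λ i → a i ℤ.* X (j ℕ.+ toℕ i)) ⟩
    sumℚ (suc d) (λ i → ι (a i ℤ.* X (j ℕ.+ toℕ i)))                ≡⟨ sumℚ-cong (suc d) term ⟩
    sumℚ (suc d) (λ i → ι C ℚ.* (ι (a i) ℚ.* at x (j ℕ.+ toℕ i)))   ≡⟨ sumℚ-scale (suc d) (ι C) (λ i → ι (a i) ℚ.* at x (j ℕ.+ toℕ i)) ⟩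
    ι C ℚ.* sumℚ (suc d) (λ i → ι (a i) ℚ.* at x (j ℕ.+ toℕ i))     ∎
    where
    open ≡-Reasoning
    swap : ∀ u v w → u ℚ.* (v ℚ.* w) ≡ v ℚ.* (u ℚ.* w)
    swap = solve 3 (λ u v w → u :* (v :* w) := v :* (u :* w)) refl
    term : ∀ i → ι (a i ℤ.* X (j ℕ.+ toℕ i)) ≡ ι C ℚ.* (ι (a i) ℚ.* at x (j ℕ.+ toℕ i))
    term i = trans (ι-* (a i) _) (trans (cong (ι (a i) ℚ.*_) (represents-at X≈x _ window<m)) (swap (ι (a i)) (ι C) _))
      where window<m = ℕP.≤-<-trans (ℕP.+-monoʳ-≤ j (ℕP.≤-pred (FinP.toℕ<n i))) j+d<m

  represents-Rec : ∀ {X x} → X Represents x → (∀ j → j ℕ.+ d < m → S X j ≡ 0ℤ) → Rec d a m x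
  represents-Rec X≈x kernel j j+d<m =
    ιC-cancel (trans (sym (window-scale X≈x j j+d<m)) (trans (cong ι (kernel j j+d<m)) (sym (ℚP.*-zeroʳ (ι C)))))

  represents-Rec⁻¹ : ∀ {X x} → X Represents x → Rec d a m x → ∀ j → j ℕ.+ d < m → S X j ≡ 0ℤ
  represents-Rec⁻¹ X≈x rec j j+d<m =
    ι-injective (trans (window-scale X≈x j j+d<m) (trans (cong (ι C ℚ.*_) (rec j j+d<m)) (ℚP.*-zeroʳ (ι C))))

module Index (d : ℕ) (a : Fin (suc d) → ℤ) (prim : Primitive d a) (c≢0 : lead d a ≢ 0ℤ) (n₁ : ℕ) where
  open Windows d a
  open Exact d a prim c≢0
  open KernelBasis n₁
  open Digits d a prim c≢0 n₁

  m : ℕ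
  m = n ℕ.+ d

  open Scaling d a {m} C (c^≢0 n)

  kernel⇒windows : ∀ X → Kernel X → ∀ j → j ℕ.+ d < m → S X j ≡ 0ℤ
  kernel⇒windows X kernel j j+d<m = kernel j (ℕP.+-cancelʳ-< d j n j+d<m)

  windows⇒kernel : ∀ X → (∀ j → j ℕ.+ d < m → S X j ≡ 0ℤ) → Kernel X
  windows⇒kernel X windows j j<n = windows j (ℕP.+-monoˡ-< d j<n)

  low-entries : ∀ Y k → k ≤ m → (∀ (i : Fin m) → toℕ i < k → C ℤ∣.∣ Y (toℕ i)) → Low C k Y
  low-entries Y k k≤m entries i i<k = subst (λ s → C ℤ∣.∣ Y s) (FinP.toℕ-fromℕ< i<m)
                                        (entries (fromℕ< i<m) (subst (_< k) (sym (FinP.toℕ-fromℕ< i<m)) i<k))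
    where i<m : i < m
          i<m = ℕP.<-≤-trans i<k k≤m

  int-scale : ∀ k {y} → IsInt y → IsInt (ι k ℚ.* y)
  int-scale k (z , refl) = k ℤ.* z , sym (ι-* k z)

  raise : ∀ {e E y} → e ≤ E → IsInt (ι (c ℤ.^ e) ℚ.* y) → IsInt (ι (c ℤ.^ E) ℚ.* y)
  raise {e} {E} {y} e≤E int = subst IsInt powers (int-scale (c ℤ.^ (E ∸ e)) int)
    where
    powers : ι (c ℤ.^ (E ∸ e)) ℚ.* (ι (c ℤ.^ e) ℚ.* y) ≡ ι (c ℤ.^ E) ℚ.* y
    powers = trans (sym (ℚP.*-assoc (ι (c ℤ.^ (E ∸ e))) (ι (c ℤ.^ e)) y)) (cong (ℚ._* y) (trans (sym (ι-* (c ℤ.^ (E ∸ e)) (c ℤ.^ e)))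
               (cong ι (trans (sym (ℤP.^-distribˡ-+-* c (E ∸ e) e)) (cong (c ℤ.^_) (ℕP.m∸n+n≡m e≤E))))))

  -- Clearing denominators.  For x ∈ Θ, c^(p+1-d)·x_p is an integer: for p ≥ d,
  -- c^(p-d) times window p - d expresses c^(p+1-d)·x_p through earlier entries.
  module Clearing (x : Fin m → ℚ) (x∈Θ : InΘ d a m x) where

    Scaled : ℕ → Set
    Scaled p = p < m → IsInt (ι (c ℤ.^ (suc p ∸ d)) ℚ.* at x p)

    -- window j multiplied by c^j: all terms but the last are integral by induction,
    -- and the sum vanishes, so the last term c^(j+1)·x_{j+d} is integral as well
    scaled-window : ∀ j → (∀ {q} → q < j ℕ.+ d → Scaled q) → j ℕ.+ d < m →
                    IsInt (ι (c ℤ.^ suc j) ℚ.* at x (j ℕ.+ d))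
    scaled-window j earlier j+d<m = subst IsInt last≡ (ℚ-Sums.sum-except integers d f (fromℕ d) others total)
      where
      f : Fin (suc d) → ℚ
      f i = ι (c ℤ.^ j) ℚ.* (ι (a i) ℚ.* at x (j ℕ.+ toℕ i))
      total : IsInt (ℚ-Sums.∑ f)
      total = 0ℤ , trans (sym (sumℚ≡∑ (suc d) f))
                    (trans (sumℚ-scale (suc d) (ι (c ℤ.^ j)) (λ i → ι (a i) ℚ.* at x (j ℕ.+ toℕ i)))
                      (trans (cong (ι (c ℤ.^ j) ℚ.*_) (proj₁ x∈Θ j j+d<m)) (ℚP.*-zeroʳ (ι (c ℤ.^ j)))))
      others : ∀ i → i ≢ fromℕ d → IsInt (f i)
      others i i≢d = subst IsInt (swap (ι (a i)) (ι (c ℤ.^ j)) (at x q))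
                       (int-scale (a i) (raise exponent (earlier q<j+d (ℕP.<-trans q<j+d j+d<m))))
        where
        q : ℕ
        q = j ℕ.+ toℕ i
        i<d : toℕ i < d
        i<d = ℕP.≤∧≢⇒< (ℕP.≤-pred (FinP.toℕ<n i)) (λ eq → i≢d (FinP.toℕ-injective (trans eq (sym (FinP.toℕ-fromℕ d)))))
        q<j+d : q < j ℕ.+ d
        q<j+d = ℕP.+-monoʳ-< j i<d
        exponent : suc q ∸ d ≤ j
        exponent = subst (suc q ∸ d ≤_) (ℕP.m+n∸n≡m j d) (ℕP.∸-monoˡ-≤ d q<j+d)
        swap : ∀ u v w → u ℚ.* (v ℚ.* w) ≡ v ℚ.* (u ℚ.* w)
        swap = solve 3 (λ u v w → u :* (v :* w) := v :* (u :* w)) refl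
      last≡ : f (fromℕ d) ≡ ι (c ℤ.^ suc j) ℚ.* at x (j ℕ.+ d)
      last≡ = begin
        ι (c ℤ.^ j) ℚ.* (ι c ℚ.* at x (j ℕ.+ toℕ (fromℕ d))) ≡⟨ cong (λ t → ι (c ℤ.^ j) ℚ.* (ι c ℚ.* at x (j ℕ.+ t))) (FinP.toℕ-fromℕ d) ⟩
        ι (c ℤ.^ j) ℚ.* (ι c ℚ.* at x (j ℕ.+ d))             ≡⟨ swap (ι (c ℤ.^ j)) (ι c) (at x (j ℕ.+ d)) ⟩
        ι c ℚ.* ι (c ℤ.^ j) ℚ.* at x (j ℕ.+ d)               ≡⟨ cong (ℚ._* at x (j ℕ.+ d)) (sym (ι-* c (c ℤ.^ j))) ⟩
        ι (c ℤ.^ suc j) ℚ.* at x (j ℕ.+ d)                   ∎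
        where
        open ≡-Reasoning
        swap : ∀ u v w → u ℚ.* (v ℚ.* w) ≡ v ℚ.* u ℚ.* w
        swap = solve 3 (λ u v w → u :* (v :* w) := v :* u :* w) refl

    scaled : ∀ p → Scaled p
    scaled = <-rec Scaled step
      where
      step : ∀ p → (∀ {q} → q < p → Scaled q) → Scaled p
      step p earlier p<m with p <? d
      ... | yes p<d = subst IsInt (sym (trans (cong (λ e → ι (c ℤ.^ e) ℚ.* at x p) (ℕP.m≤n⇒m∸n≡0 p<d))
                                       (trans (ℚP.*-identityˡ (at x p)) (at-lt x p p<m))))
                                (proj₂ x∈Θ (fromℕ< p<m) (subst (_< d) (sym (FinP.toℕ-fromℕ< p<m)) p<d))
      ... | no  p≮d = subst (λ q → IsInt (ι (c ℤ.^ (suc q ∸ d)) ℚ.* at x q)) j+d≡p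
                        (subst (λ e → IsInt (ι (c ℤ.^ e) ℚ.* at x (j ℕ.+ d))) (sym (ℕP.m+n∸n≡m (suc j) d))
                          (scaled-window j (subst (λ q → ∀ {q′} → q′ < q → Scaled q′) (sym j+d≡p) earlier)
                                           (subst (_< m) (sym j+d≡p) p<m)))
        where
        j : ℕ
        j = p ∸ d
        j+d≡p : j ℕ.+ d ≡ p
        j+d≡p = ℕP.m∸n+n≡m (ℕP.≮⇒≥ p≮d)

    numerators : Σ Seq λ X → X Represents x
    numerators = X , X≈x
      where
      integral : ∀ p → p < m → IsInt (ι C ℚ.* at x p)
      integral p p<m = raise (subst (suc p ∸ d ≤_) (ℕP.m+n∸n≡m n d) (ℕP.∸-monoˡ-≤ d p<m)) (scaled p p<m)
      X : Seq
      X = proj₁ (integer-part m (λ p → ι C ℚ.* at x p) integral)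
      X≈x : X Represents x
      X≈x = represents λ i → sym (trans (cong (ι C ℚ.*_) (sym (trans (at-lt x (toℕ i) (FinP.toℕ<n i)) (cong x (FinP.fromℕ<-toℕ i _)))))
                                (proj₂ (integer-part m (λ p → ι C ℚ.* at x p) integral) (toℕ i) (FinP.toℕ<n i)))

  basis : Fin n → Seq
  basis t = proj₁ (kernelElement (toℕ t) (FinP.toℕ<n t))

  basis-family : Family 0 n basis
  basis-family t = proj₂ (kernelElement (toℕ t) (FinP.toℕ<n t))

  digitsOf : Fin (b ^ n) → Fin n → Fin b
  digitsOf = finToFun {b} {n}

  number : (Fin n → Fin b) → Fin (b ^ n)
  number = funToFin {n} {b}

  W : Fin (b ^ n) → Seq
  W k = comb (digitsOf k) basis

  r : Fin (b ^ n) → Fin m → ℚ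
  r k i = ι (W k (toℕ i)) ℚ.* ℚ.1/ ι C

  r∈Θ : ∀ k → InΘ d a m (r k)
  r∈Θ k = represents-Rec (divide (W k)) (kernel⇒windows (W k) kernel)
        , λ i i<d → represents-int (divide (W k)) i (low (toℕ i) i<d)
    where
    kernel : Kernel (W k)
    kernel = comb-closed kernel-closed (digitsOf k) basis (KernelElement.kernel ∘ basis-family)
    low : Low C d (W k)
    low = comb-closed (low-closed C d) (digitsOf k) basis (family-low basis-family)

  -- x ∈ Θ: its numerators X lie in the kernel and are ≡ 0 mod C below d; cover X by a digit combination.
  covered : ∀ x → InΘ d a m x → ∃ λ k → InΛ d a m (x ⊖ r k)
  covered x x∈Θ = k , represents-Rec diff (kernel⇒windows (X ⊝ W k) diff-kernel) , λ i → represents-int diff i (diff-low (toℕ i) (FinP.toℕ<n i))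
    where
    open Clearing x x∈Θ
    X : Seq
    X = proj₁ numerators
    X≈x : X Represents x
    X≈x = proj₂ numerators
    X-kernel : Kernel X
    X-kernel = windows⇒kernel X (represents-Rec⁻¹ X≈x (proj₁ x∈Θ))
    X-low : Low C d X
    X-low = low-entries X d (ℕP.m≤n+m d n) (λ i i<d → represents-int⁻¹ X≈x i (proj₂ x∈Θ i i<d))
    expansion : Σ (Fin n → Fin b) λ l → Low C m (X ⊝ comb l basis)
    expansion = cover n 0 basis basis-family ℕP.≤-refl X X-kernel X-low
    k : Fin (b ^ n)
    k = number (proj₁ expansion)
    W≗ : ∀ i → comb (proj₁ expansion) basis i ≡ W k i
    W≗ = comb-cong basis (λ t → sym (FinP.finToFun-funToFin {n} {b} (proj₁ expansion) t))
    diff : (X ⊝ W k) Represents (x ⊖ r k)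
    diff = represents-⊝ X≈x (divide (W k))
    diff-kernel : Kernel (X ⊝ W k)
    diff-kernel = Closed.⊝∈ kernel-closed {X} {W k} X-kernel
                    (comb-closed kernel-closed (digitsOf k) basis (KernelElement.kernel ∘ basis-family))
    diff-low : Low C m (X ⊝ W k)
    diff-low = low-cong (λ i → cong (λ w → X i ℤ.+ -1ℤ ℤ.* w) (W≗ i)) (proj₂ expansion)

  -- distinct representatives are inequivalent: their numerators differ by a
  -- multiple of C only if the digits agree
  distinct : ∀ k k′ → InΛ d a m (r k ⊖ r k′) → k ≡ k′
  distinct k k′ (_ , integral) = begin
    k                        ≡⟨ sym (FinP.funToFin-finToFin {n} {b} k) ⟩
    number (digitsOf k)      ≡⟨ funToFin-cong (digitsOf k) (digitsOf k′) same-digits ⟩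
    number (digitsOf k′)     ≡⟨ FinP.funToFin-finToFin {n} {b} k′ ⟩
    k′                       ∎
    where
    open ≡-Reasoning
    low : Low C m (W k ⊝ W k′)
    low = low-entries (W k ⊝ W k′) m ℕP.≤-refl
            (λ i _ → represents-int⁻¹ (represents-⊝ (divide (W k)) (divide (W k′))) i (integral i))
    same-digits : ∀ t → digitsOf k t ≡ digitsOf k′ t
    same-digits = irredundant n 0 basis basis-family (digitsOf k) (digitsOf k′) low

  hasIndex : HasIndex d a m (b ^ n)
  hasIndex = r , r∈Θ , covered , distinct

corollary1 : (d : ℕ) (a : Fin (suc d) → ℤ) (m : ℕ) →
    Primitive d a → lead d a ≢ 0ℤ → a Fin.zero ≢ 0ℤ → d < m →
    HasIndex d a m (∣ lead d a ∣ ^ (m ∸ d))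
corollary1 d a m prim c≢0 _ d<m = subst (λ m → HasIndex d a m (∣ lead d a ∣ ^ (m ∸ d))) n+d≡m
  (subst (λ e → HasIndex d a (suc n₁ ℕ.+ d) (∣ lead d a ∣ ^ e)) (sym (ℕP.m+n∸n≡m (suc n₁) d))
    (Index.hasIndex d a prim c≢0 n₁))
  where
  n₁ : ℕ
  n₁ = proj₁ (ℕP.m≤n⇒∃[o]m+o≡n d<m)
  n+d≡m : suc n₁ ℕ.+ d ≡ m
  n+d≡m = trans (cong suc (ℕP.+-comm n₁ d)) (proj₂ (ℕP.m≤n⇒∃[o]m+o≡n d<m))
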